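{- Let $t,t',\Delta\in\mathbb{N}$ with $t\ge t'$. If $A$ $(t,\Delta)$-approximates $B$, then $A\cap[t']$ $(t',\Delta)$-approximates $B\cap[t']$.
   Context: $\mathbb{N}=\{0,1,2,\dots\}$, $[t]=\{0,1,\dots,t\}$. For $A\subseteq[t]$ and $b\in\mathbb{N}$ define $\mathrm{apx}^-_t(b,A)=\max\{a\in A\cup\{t+1\}\mid a\le b\}$ and $\mathrm{apx}^+_t(b,A)=\min\{a\in A\cup\{t+1\}\mid a\ge b\}$, with $\max\emptyset=-\infty$, $\min\emptyset=\infty$. "$A$ $(t,\Delta)$-approximates $B$" means $A\subseteq B\subseteq[t]$ and for every $b\in B$, $\mathrm{apx}^+_t(b,A)-\mathrm{apx}^-_t(b,A)\le\Delta$. -}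

module Defs where

open import Data.Nat using (ℕ; zero; suc; _+_; _∸_; _≤_; _≤ᵇ_)
open import Data.Bool using (Bool; true; false; _∧_; _∨_; T; if_then_else_)
open import Data.Maybe using (Maybe; just; nothing)
open import Data.Empty using (⊥)
open import Data.Product using (_×_)

NSet : Set
NSet = ℕ → Bool

_∈_ : ℕ → NSet → Set
n ∈ A = T (A n)

_⊆_ : NSet → NSet → Set
A ⊆ B = ∀ n → n ∈ A → n ∈ B

upto : ℕ → NSet
upto t n = n ≤ᵇ t

_∩_ : NSet → NSet → NSet
(A ∩ B) n = A n ∧ B n

withTop : ℕ → NSet → NSet
withTop t A n = A n ∨ (n Data.Nat.≡ᵇ suc t)

-- maxBelow S b = max {a ∈ S | a ≤ b}, nothing encodes max ∅ = -∞
maxBelow : NSet → ℕ → Maybe ℕ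
maxBelow S zero = if S zero then just zero else nothing
maxBelow S (suc b) = if S (suc b) then just (suc b) else maxBelow S b

-- minAbove S b bound = min {a ∈ S | b ≤ a}, searching up to b + fuel;
-- nothing encodes min ∅ = ∞ (only used where S ∋ t+1, see apx⁺)
minFrom : NSet → ℕ → ℕ → Maybe ℕ
minFrom S b zero = if S b then just b else nothing
minFrom S b (suc k) = if S b then just b else minFrom S (suc b) k

apx⁻ : ℕ → ℕ → NSet → Maybe ℕ
apx⁻ t b A = maxBelow (withTop t A) b

-- apx⁺_t(b,A) = min {a ∈ A ∪ {t+1} | a ≥ b}   (nothing = +∞)
-- For A ⊆ [t], every such a satisfies a ≤ t+1, so searching b..t+1 is exhaustive.
apx⁺ : ℕ → ℕ → NSet → Maybe ℕ
apx⁺ t b A = minFrom (withTop t A) b (suc t ∸ b)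

-- apx⁺ - apx⁻ ≤ Δ in the extended integers: any infinite value makes it false.
gapOK : Maybe ℕ → Maybe ℕ → ℕ → Set
gapOK (just p) (just m) Δ = p ∸ m ≤ Δ
gapOK _ _ Δ = ⊥

Approximates : ℕ → ℕ → NSet → NSet → Set
Approximates t Δ A B =
  A ⊆ B × B ⊆ upto t ×
  (∀ b → b ∈ B → gapOK (apx⁺ t b A) (apx⁻ t b A) Δ)

-- For b ≤ t' the sets A ∪ {t+1} and (A ∩ [t']) ∪ {t'+1} agree on [0, t'], so the
-- lower approximation of b is unchanged. The upper one can only decrease: either it
-- was some a ≤ t', which is still available, or it was ≥ t'+1, and t'+1 is now available.
module Submission where

open import Defs
open import Data.Nat using (ℕ; _≥_; zero; suc; _+_; _∸_; _≤_; _<_; _≤?_; _≡ᵇ_; z≤n; s≤s; s<s)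
open import Data.Nat.Properties
open import Data.Bool using (true; false; _∧_; _∨_; T; if_then_else_)
open import Data.Bool.Properties using (T-∧; T-∨; T-≡; ∧-identityʳ)
open import Data.Maybe using (Maybe; just; nothing)
open import Data.Empty using (⊥-elim)
open import Data.Product using (_×_; _,_; proj₁; proj₂; map₁)
open import Data.Sum using (inj₁; inj₂)
open import Function.Bundles using (Equivalence)
open import Relation.Binary.PropositionalEquality
open import Relation.Nullary using (yes; no)

open Equivalence using (to; from)

<⇒≡ᵇ-false : ∀ {m n} → m < n → (m ≡ᵇ n) ≡ false
<⇒≡ᵇ-false {zero}  {suc n} _         = refl
<⇒≡ᵇ-false {suc m} {suc n} (s<s m<n) = <⇒≡ᵇ-false m<n

-- The order of ℕ ∪ {∞}, with nothing as ∞.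
data _≤∞_ : Maybe ℕ → Maybe ℕ → Set where
  just≤just : ∀ {m n} → m ≤ n → just m ≤∞ just n
  _≤∞nothing : ∀ p → p ≤∞ nothing

≤∞-trans : ∀ {p q r} → p ≤∞ q → q ≤∞ r → p ≤∞ r
≤∞-trans (just≤just m≤n) (just≤just n≤o) = just≤just (≤-trans m≤n n≤o)
≤∞-trans _               (_ ≤∞nothing)   = _ ≤∞nothing

gapOK-antitoneˡ : ∀ {p p' m Δ} → p' ≤∞ p → gapOK p m Δ → gapOK p' m Δ
gapOK-antitoneˡ {m = just m} (just≤just p'≤p) gap = ≤-trans (∸-monoˡ-≤ m p'≤p) gap

maxBelow-cong : ∀ (S S' : NSet) b → (∀ n → n ≤ b → S n ≡ S' n) →
  maxBelow S b ≡ maxBelow S' b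
maxBelow-cong S S' zero    S≗S' rewrite S≗S' zero z≤n = refl
maxBelow-cong S S' (suc b) S≗S' rewrite S≗S' (suc b) ≤-refl =
  cong (if S' (suc b) then just (suc b) else_)
       (maxBelow-cong S S' b (λ n n≤b → S≗S' n (m≤n⇒m≤1+n n≤b)))

minFrom-sound : ∀ S b k {p} → minFrom S b k ≡ just p → p ∈ S × b ≤ p
minFrom-sound S b zero eq with S b in Sb
... | true with refl ← eq = from T-≡ Sb , ≤-refl
minFrom-sound S b (suc k) eq with S b in Sb
... | true with refl ← eq = from T-≡ Sb , ≤-refl
... | false = let p∈S , sb≤p = minFrom-sound S (suc b) k eq in p∈S , ≤-trans (n≤1+n b) sb≤p

minFrom-start : ∀ S b k → b ∈ S → minFrom S b k ≡ just b
minFrom-start S b zero    b∈S rewrite to T-≡ b∈S = refl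
minFrom-start S b (suc k) b∈S rewrite to T-≡ b∈S = refl

minFrom-least : ∀ S b k {c} → c ∈ S → b ≤ c → c ≤ b + k → minFrom S b k ≤∞ just c
minFrom-least S b k {c} c∈S b≤c c≤b+k with m≤n⇒m<n∨m≡n b≤c | k
... | inj₂ refl | k' = subst (_≤∞ just b) (sym (minFrom-start S b k' c∈S)) (just≤just ≤-refl)
... | inj₁ b<c | zero = ⊥-elim (<⇒≱ b<c (subst (c ≤_) (+-identityʳ b) c≤b+k))
... | inj₁ b<c | suc k' with S b
...   | true  = just≤just b≤c
...   | false = minFrom-least S (suc b) k' c∈S b<c (subst (c ≤_) (+-suc b k') c≤b+k)

top∈withTop : ∀ t A → suc t ∈ withTop t A
top∈withTop t A = from T-∨ (inj₂ (≡⇒≡ᵇ (suc t) (suc t) refl))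

withTop-∩upto-agree : ∀ {t t'} A → t' ≤ t → ∀ {n} → n ≤ t' →
  withTop t A n ≡ withTop t' (A ∩ upto t') n
withTop-∩upto-agree A t'≤t {n} n≤t'
  rewrite <⇒≡ᵇ-false (s≤s (≤-trans n≤t' t'≤t)) | <⇒≡ᵇ-false (s≤s n≤t') | to T-≡ (≤⇒≤ᵇ n≤t')
  = cong (_∨ false) (sym (∧-identityʳ (A n)))

apx⁺-least : ∀ t A {b c} → c ∈ withTop t A → b ≤ c → c ≤ suc t → apx⁺ t b A ≤∞ just c
apx⁺-least t A {b} {c} c∈S b≤c c≤1+t =
  minFrom-least (withTop t A) b (suc t ∸ b) c∈S b≤c
    (subst (c ≤_) (sym (m+[n∸m]≡n (≤-trans b≤c c≤1+t))) c≤1+t)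

apx⁺-∩upto : ∀ {t t' b} A → t' ≤ t → b ≤ t' → apx⁺ t' b (A ∩ upto t') ≤∞ apx⁺ t b A
apx⁺-∩upto {t} {t'} {b} A t'≤t b≤t' with apx⁺ t b A in eq
... | nothing = _ ≤∞nothing
... | just x with minFrom-sound (withTop t A) b (suc t ∸ b) eq | x ≤? t'
...   | x∈S , b≤x | yes x≤t' =
  apx⁺-least t' (A ∩ upto t') (subst T (withTop-∩upto-agree A t'≤t x≤t') x∈S) b≤x (m≤n⇒m≤1+n x≤t')
...   | _ | no x≰t' =
  ≤∞-trans (apx⁺-least t' (A ∩ upto t') (top∈withTop t' (A ∩ upto t')) (m≤n⇒m≤1+n b≤t') ≤-refl)
           (just≤just (≰⇒> x≰t'))

apx⁻-∩upto : ∀ {t t' b} A → t' ≤ t → b ≤ t' → apx⁻ t' b (A ∩ upto t') ≡ apx⁻ t b A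
apx⁻-∩upto {b = b} A t'≤t b≤t' =
  sym (maxBelow-cong _ _ b (λ n n≤b → withTop-∩upto-agree A t'≤t (≤-trans n≤b b≤t')))

lemma4p8 : (t t' Δ : ℕ) (A B : NSet) → t ≥ t' →
    Approximates t Δ A B →
    Approximates t' Δ (A ∩ upto t') (B ∩ upto t')
lemma4p8 t t' Δ A B t≥t' (A⊆B , _ , gap) = A'⊆B' , B'⊆[t'] , gap'
  where
  A'⊆B' : (A ∩ upto t') ⊆ (B ∩ upto t')
  A'⊆B' n n∈A' = from T-∧ (map₁ (A⊆B n) (to T-∧ n∈A'))

  B'⊆[t'] : (B ∩ upto t') ⊆ upto t'
  B'⊆[t'] n n∈B' = proj₂ (to T-∧ n∈B')

  gap' : ∀ b → b ∈ (B ∩ upto t') → gapOK (apx⁺ t' b (A ∩ upto t')) (apx⁻ t' b (A ∩ upto t')) Δ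
  gap' b b∈B' = subst (λ m → gapOK _ m Δ) (sym (apx⁻-∩upto A t≥t' b≤t'))
                  (gapOK-antitoneˡ (apx⁺-∩upto A t≥t' b≤t') (gap b (proj₁ (to T-∧ b∈B'))))
    where
    b≤t' : b ≤ t'
    b≤t' = ≤ᵇ⇒≤ b t' (B'⊆[t'] b b∈B')
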